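{- Let $n,q,t$ be positive integers with $t\ge 3$ and $n\ge 2$, and let $r\in\{0,1,\dots,t-2\}$ be the remainder of $n$ on division by $t-1$. If $M(\overline{t},n,q)>q$, then $$M(\overline{t},n,q)\le\max\{q^{\lceil n/(t-1)\rceil},\; r(q^{\lceil n/(t-1)\rceil}-1)+(t-1-r)(q^{\lfloor n/(t-1)\rfloor}-1)\}.$$
   Context: An $(n,M,q)$ code is a set $\mathcal{C}\subseteq Q^n$ of $M$ distinct codewords, $|Q|=q$. For $\mathcal{C}_0\subseteq\mathcal{C}$, let $\mathcal{C}_0(i)=\{\mathbf{c}(i):\mathbf{c}\in\mathcal{C}_0\}$ and $\mathsf{desc}(\mathcal{C}_0)=\mathcal{C}_0(1)\times\cdots\times\mathcal{C}_0(n)$. $\mathcal{C}$ is a strongly $\overline{t}$-separable code ($\overline{t}$-SSC$(n,M,q)$) if for every $\mathcal{C}_0\subseteq\mathcal{C}$ with $1\le|\mathcal{C}_0|\le t$, $\bigcap_{\mathcal{C}'\in S(\mathcal{C}_0)}\mathcal{C}'=\mathcal{C}_0$, where $S(\mathcal{C}_0)=\{\mathcal{C}'\subseteq\mathcal{C}:\mathsf{desc}(\mathcal{C}')=\mathsf{desc}(\mathcal{C}_0)\}$. $M(\overline{t},n,q)$ denotes the maximum $M$ such that a $\overline{t}$-SSC$(n,M,q)$ exists. -}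

module Defs where

open import Data.Nat using (ℕ; zero; suc; _+_; _*_; _∸_; _^_; _≤_; _<_; _⊔_)
open import Data.Nat.DivMod using (_/_; _%_)
open import Data.Fin using (Fin)
open import Data.Fin.Subset using (Subset; _∈_; ∣_∣)
open import Data.Product using (Σ; _×_; ∃)
open import Function.Definitions using (Injective)
open import Relation.Binary.PropositionalEquality using (_≡_)

Word : ℕ → ℕ → Set
Word n q = Fin n → Fin q

record Code (n M q : ℕ) : Set where
  field
    word     : Fin M → Word n q
    distinct : Injective _≡_ _≡_ word
open Code public

-- A subcode C₀ ⊆ C is a subset of the index set Fin M.
-- w ∈ desc(C₀)  iff  for every coordinate i, w(i) ∈ C₀(i).
InDesc : ∀ {n M q} → Code n M q → Subset M → Word n q → Set
InDesc C S w = ∀ i → ∃ λ j → j ∈ S × word C j i ≡ w i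

SameDesc : ∀ {n M q} → Code n M q → Subset M → Subset M → Set
SameDesc C S′ S = ∀ w → (InDesc C S′ w → InDesc C S w) × (InDesc C S w → InDesc C S′ w)

-- Strongly t̄-separable: for every C₀ with 1 ≤ |C₀| ≤ t, the intersection of all
-- C' ∈ S(C₀) equals C₀ (membership-wise, for every codeword index j).
StronglySeparable : ∀ {n M q} → ℕ → Code n M q → Set
StronglySeparable {M = M} t C =
  ∀ (S : Subset M) → 1 ≤ ∣ S ∣ → ∣ S ∣ ≤ t → ∀ (j : Fin M) →
    ((∀ (S′ : Subset M) → SameDesc C S′ S → j ∈ S′) → j ∈ S) ×
    (j ∈ S → ∀ (S′ : Subset M) → SameDesc C S′ S → j ∈ S′)

-- Ceiling division by d+1 (we write divisors as suc d so NonZero is automatic).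
⌈_/suc_⌉ : ℕ → ℕ → ℕ
⌈ n /suc d ⌉ = (n + d) / suc d

-- The bound  max{ q^⌈n/(t-1)⌉ , r(q^⌈n/(t-1)⌉ - 1) + (t-1-r)(q^⌊n/(t-1)⌋ - 1) }
-- with t - 1 = suc (t ∸ 2) (valid since t ≥ 3) and r = n mod (t-1).
bound : ℕ → ℕ → ℕ → ℕ
bound t n q =
  let d  = t ∸ 2
      r  = n % suc d
      up = q ^ ⌈ n /suc d ⌉
      lo = q ^ (n / suc d)
  in up ⊔ (r * (up ∸ 1) + (suc d ∸ r) * (lo ∸ 1))

-- Write t − 1 = d + 1 and split the n coordinates into d + 1 blocks: r = n mod (d+1)
-- blocks of length ⌈n/(d+1)⌉ and the others of length ⌊n/(d+1)⌋.
--
-- Separation: every codeword m of a t̄-SSC is identified by some block, i.e. no other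
-- codeword agrees with m on it.  Otherwise choose, for every block, a codeword ≠ m
-- agreeing with m there; these at most t − 1 codewords realise every coordinate of m,
-- so adding m to them does not change desc, and strong separability forces m to be
-- one of them.
--
-- Counting: if some block separates all codewords, then M ≤ q^⌈n/(t−1)⌉.  Otherwise
-- every block b carries a pattern shared by two distinct codewords; that pattern is
-- never identifying, so m ↦ (identifying block, restriction of m to it) injects the
-- code into Σ_b (q^|b| − 1) = r(q^⌈n/(t−1)⌉ − 1) + (t−1−r)(q^⌊n/(t−1)⌋ − 1).
--
-- The argument
-- needs only t ≥ 2 and q ≥ 1.
module Submission where

open import Defs
open import Data.Nat using (ℕ; zero; suc; _+_; _*_; _∸_; _^_; _≤_; _<_; z≤n; s≤s; NonZero)
import Data.Nat.Properties as ℕₚ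
open import Data.Nat.DivMod
  using (_/_; _%_; m≡m%n+[m/n]*n; m%n<n; +-distrib-/-∣ʳ; m*n/n≡m; m/n≡1+[m∸n]/n; m<n⇒m/n≡0)
open import Data.Nat.Divisibility using (divides-refl)
open import Algebra.Properties.CommutativeSemigroup ℕₚ.+-commutativeSemigroup using (xy∙z≈xz∙y)
open import Data.Fin as Fin using (Fin; cast; join; splitAt; combine; remQuot; punchOut; funToFin; finToFun)
open import Data.Fin.Properties
  using (_≟_; any?; all?; ¬∀⟶∃¬; injective⇒≤; cast-involutive; splitAt-join; join-splitAt;
         remQuot-combine; combine-remQuot; finToFun-funToFin; punchOut-injective)
open import Data.Fin.Subset using (Subset; ∣_∣; _∪_; ⁅_⁆; ⊥; inside; outside; _∈_; _∉_; _⊆_)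
open import Data.Fin.Subset.Properties
  using (∣⊥∣≡0; ∣⁅x⁆∣≡1; ∣p∣≤∣p∪q∣; ∉⊥; x∈⁅x⁆; x∈⁅y⁆⇒x≡y; q⊆p∪q; x∈p∪q⁻; x∈p∪q⁺)
open import Data.Vec using (_∷_; [])
open import Data.Product using (Σ; ∃; ∃₂; _×_; _,_; proj₁; proj₂; uncurry)
open import Data.Product.Properties using (Σ-≡,≡←≡)
open import Data.Sum using (_⊎_; inj₁; inj₂)
open import Function using (_∘_)
open import Function.Definitions using (Injective)
open import Relation.Nullary using (¬_; Dec; yes; no; ¬?; contradiction)
open import Relation.Nullary.Decidable using (_×-dec_; decidable-stable)
open import Relation.Binary.PropositionalEquality

∣p∪q∣≤∣p∣+∣q∣ : ∀ {k} (p q : Subset k) → ∣ p ∪ q ∣ ≤ ∣ p ∣ + ∣ q ∣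
∣p∪q∣≤∣p∣+∣q∣ []            []            = z≤n
∣p∪q∣≤∣p∣+∣q∣ (outside ∷ p) (outside ∷ q) = ∣p∪q∣≤∣p∣+∣q∣ p q
∣p∪q∣≤∣p∣+∣q∣ (outside ∷ p) (inside ∷ q)  =
  ℕₚ.≤-trans (s≤s (∣p∪q∣≤∣p∣+∣q∣ p q)) (ℕₚ.≤-reflexive (sym (ℕₚ.+-suc ∣ p ∣ ∣ q ∣)))
∣p∪q∣≤∣p∣+∣q∣ (inside ∷ p)  (outside ∷ q) = s≤s (∣p∪q∣≤∣p∣+∣q∣ p q)
∣p∪q∣≤∣p∣+∣q∣ (inside ∷ p)  (inside ∷ q)  =
  s≤s (ℕₚ.≤-trans (∣p∪q∣≤∣p∣+∣q∣ p q) (ℕₚ.+-monoʳ-≤ ∣ p ∣ (ℕₚ.n≤1+n ∣ q ∣)))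

image : ∀ {M} k → (Fin k → Fin M) → Subset M
image zero    h = ⊥
image (suc k) h = ⁅ h Fin.zero ⁆ ∪ image k (h ∘ Fin.suc)

∣image∣≤ : ∀ {M} k (h : Fin k → Fin M) → ∣ image k h ∣ ≤ k
∣image∣≤ {M} zero h = ℕₚ.≤-reflexive (∣⊥∣≡0 M)
∣image∣≤ (suc k) h = ℕₚ.≤-trans (∣p∪q∣≤∣p∣+∣q∣ ⁅ h Fin.zero ⁆ _)
  (ℕₚ.+-mono-≤ (ℕₚ.≤-reflexive (∣⁅x⁆∣≡1 (h Fin.zero))) (∣image∣≤ k (h ∘ Fin.suc)))

∈image : ∀ {M} k (h : Fin k → Fin M) i → h i ∈ image k h
∈image (suc k) h Fin.zero    = x∈p∪q⁺ (inj₁ (x∈⁅x⁆ (h Fin.zero)))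
∈image (suc k) h (Fin.suc i) = x∈p∪q⁺ (inj₂ (∈image k (h ∘ Fin.suc) i))

∈image⁻ : ∀ {M} k (h : Fin k → Fin M) {x} → x ∈ image k h → ∃ λ i → h i ≡ x
∈image⁻ zero    h x∈ = contradiction x∈ ∉⊥
∈image⁻ (suc k) h x∈ with x∈p∪q⁻ ⁅ h Fin.zero ⁆ _ x∈
... | inj₁ x∈⁅h0⁆ = Fin.zero , sym (x∈⁅y⁆⇒x≡y _ x∈⁅h0⁆)
... | inj₂ x∈rest = let (i , hi≡x) = ∈image⁻ k (h ∘ Fin.suc) x∈rest in Fin.suc i , hi≡x

module _ {n M q : ℕ} (C : Code n M q) where

  InDesc-mono : ∀ {S S′ : Subset M} {w} → S ⊆ S′ → InDesc C S w → InDesc C S′ w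
  InDesc-mono S⊆S′ w∈ i = let (j , j∈S , e) = w∈ i in j , S⊆S′ j∈S , e

  absorb : ∀ {S : Subset M} {m} → InDesc C S (word C m) → SameDesc C S (⁅ m ⁆ ∪ S)
  absorb {S} {m} m-covered w = InDesc-mono (q⊆p∪q ⁅ m ⁆ S) , shrink
    where
    shrink : InDesc C (⁅ m ⁆ ∪ S) w → InDesc C S w
    shrink w∈ i with w∈ i
    ... | j , j∈ , e with x∈p∪q⁻ ⁅ m ⁆ S j∈
    ...   | inj₂ j∈S  = j , j∈S , e
    ...   | inj₁ j∈⁅m⁆ with refl ← x∈⁅y⁆⇒x≡y m j∈⁅m⁆ =
      let (j′ , j′∈S , e′) = m-covered i in j′ , j′∈S , trans e′ e

  covered⇒member : ∀ {t} {S : Subset M} {m} → StronglySeparable t C →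
                   ∣ ⁅ m ⁆ ∪ S ∣ ≤ t → InDesc C S (word C m) → m ∈ S
  covered⇒member {S = S} {m} sep small m-covered =
    proj₂ (sep (⁅ m ⁆ ∪ S) nonempty small m) (x∈p∪q⁺ (inj₁ (x∈⁅x⁆ m))) S (absorb m-covered)
    where
    nonempty : 1 ≤ ∣ ⁅ m ⁆ ∪ S ∣
    nonempty = ℕₚ.≤-trans (ℕₚ.≤-reflexive (sym (∣⁅x⁆∣≡1 m))) (∣p∣≤∣p∪q∣ ⁅ m ⁆ S)

record Cover (n : ℕ) : Set₁ where
  field
    Block     : Set
    count     : ℕ
    enum      : Fin count → Block
    enum-onto : ∀ b → ∃ λ j → enum j ≡ b
    size      : Block → ℕ
    pos       : (b : Block) → Fin (size b) → Fin n
    pos-onto  : ∀ i → ∃₂ λ b p → pos b p ≡ i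

cast-injective : ∀ {a b} .(e : a ≡ b) {x y : Fin a} → cast e x ≡ cast e y → x ≡ y
cast-injective e {x} {y} cx≡cy = begin
  x                       ≡⟨ sym (cast-involutive (sym e) e x) ⟩
  cast (sym e) (cast e x) ≡⟨ cong (cast (sym e)) cx≡cy ⟩
  cast (sym e) (cast e y) ≡⟨ cast-involutive (sym e) e y ⟩
  y                       ∎
  where open ≡-Reasoning

module BlockArgument {n M q : ℕ} (C : Code n M q) (cover : Cover n) where
  open Cover cover

  restriction : (b : Block) → Fin M → Fin (q ^ size b)
  restriction b m = funToFin (λ p → word C m (pos b p))

  restriction-agree : ∀ {b m m′} → restriction b m ≡ restriction b m′ →
                      ∀ p → word C m (pos b p) ≡ word C m′ (pos b p)
  restriction-agree {b} {m} {m′} e p = begin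
    word C m (pos b p)              ≡⟨ sym (finToFun-funToFin (λ p → word C m (pos b p)) p) ⟩
    finToFun (restriction b m) p    ≡⟨ cong (λ x → finToFun x p) e ⟩
    finToFun (restriction b m′) p   ≡⟨ finToFun-funToFin (λ p → word C m′ (pos b p)) p ⟩
    word C m′ (pos b p)             ∎
    where open ≡-Reasoning

  Identifies : Block → Fin M → Set
  Identifies b m = ∀ m′ → restriction b m′ ≡ restriction b m → m′ ≡ m

  Twin : Block → Fin M → Set
  Twin b m = ∃ λ m′ → restriction b m′ ≡ restriction b m × m′ ≢ m

  twin? : ∀ b m → Dec (Twin b m)
  twin? b m = any? (λ m′ → (restriction b m′ ≟ restriction b m) ×-dec ¬? (m′ ≟ m))

  no-twin⇒identifies : ∀ {b m} → ¬ Twin b m → Identifies b m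
  no-twin⇒identifies {m = m} no-twin m′ e = decidable-stable (m′ ≟ m) (λ m′≢m → no-twin (m′ , e , m′≢m))

  Ambiguous : Block → Set
  Ambiguous b = ∃₂ λ m₁ m₂ → m₁ ≢ m₂ × restriction b m₁ ≡ restriction b m₂

  ambiguous? : ∀ b → Dec (Ambiguous b)
  ambiguous? b = any? λ m₁ → any? λ m₂ → ¬? (m₁ ≟ m₂) ×-dec (restriction b m₁ ≟ restriction b m₂)

  unambiguous⇒injective : ∀ {b} → ¬ Ambiguous b → Injective _≡_ _≡_ (restriction b)
  unambiguous⇒injective unamb {m₁} {m₂} e = decidable-stable (m₁ ≟ m₂) (λ m₁≢m₂ → unamb (m₁ , m₂ , m₁≢m₂ , e))

  every-block-or-exception : {P : Block → Set} → (∀ b → Dec (P b)) → (∀ b → P b) ⊎ ∃ λ b → ¬ P b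
  every-block-or-exception {P} P? with all? (P? ∘ enum)
  ... | yes all = inj₁ λ b → let (j , ej≡b) = enum-onto b in subst P ej≡b (all j)
  ... | no ¬all = let (j , ¬Pj) = ¬∀⟶∃¬ count (P ∘ enum) (P? ∘ enum) ¬all in inj₂ (enum j , ¬Pj)

  identifying-block : ∀ {t} → StronglySeparable t C → count < t → ∀ m → ∃ λ b → Identifies b m
  identifying-block {t} sep count<t m with every-block-or-exception (λ b → twin? b m)
  ... | inj₂ (b , no-twin) = b , no-twin⇒identifies no-twin
  ... | inj₁ twin          = contradiction (covered⇒member C sep small covered) m∉twins
    where
    twinOf : Block → Fin M
    twinOf b = proj₁ (twin b)

    twins : Subset M
    twins = image count (twinOf ∘ enum)

    twinOf∈twins : ∀ b → twinOf b ∈ twins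
    twinOf∈twins b = let (j , ej≡b) = enum-onto b in
      subst (λ b → twinOf b ∈ twins) ej≡b (∈image count (twinOf ∘ enum) j)

    m∉twins : m ∉ twins
    m∉twins m∈ = let (j , e) = ∈image⁻ count (twinOf ∘ enum) m∈ in proj₂ (proj₂ (twin (enum j))) e

    -- Every coordinate of m is realised by the twin on the block containing it.
    covered : InDesc C twins (word C m)
    covered i = let (b , p , pos≡i) = pos-onto i in
      twinOf b , twinOf∈twins b ,
      subst (λ i → word C (twinOf b) i ≡ word C m i) pos≡i (restriction-agree (proj₁ (proj₂ (twin b))) p)

    small : ∣ ⁅ m ⁆ ∪ twins ∣ ≤ t
    small = ℕₚ.≤-trans (∣p∪q∣≤∣p∣+∣q∣ ⁅ m ⁆ twins)
      (ℕₚ.≤-trans (ℕₚ.+-mono-≤ (ℕₚ.≤-reflexive (∣⁅x⁆∣≡1 m)) (∣image∣≤ count _)) count<t)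

  -- Counting lemma: if every block is ambiguous, then m ↦ (identifying block of m,
  -- restriction of m with the shared pattern removed) is injective.  Here R b + 1 = q^(size b).
  module AllAmbiguous (R : Block → ℕ) (R-spec : ∀ b → q ^ size b ≡ suc (R b))
                      (ambiguous : ∀ b → Ambiguous b) (identify : ∀ m → ∃ λ b → Identifies b m) where

    shared : (b : Block) → Fin (q ^ size b)
    shared b = restriction b (proj₁ (ambiguous b))

    identifying≢shared : ∀ {b m} → Identifies b m → shared b ≢ restriction b m
    identifying≢shared {b} idm e with ambiguous b
    ... | m₁ , m₂ , m₁≢m₂ , e₁₂ = m₁≢m₂ (trans (idm m₁ e) (sym (idm m₂ (trans (sym e₁₂) e))))

    residue : ∀ {b m} → Identifies b m → Fin (R b)
    residue {b} idm = punchOut {i = cast (R-spec b) (shared b)}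
      (identifying≢shared idm ∘ cast-injective (R-spec b))

    residue-injective : ∀ {b m m′} (idm : Identifies b m) (idm′ : Identifies b m′) →
                        residue idm ≡ residue idm′ → m ≡ m′
    residue-injective {b} {m} idm idm′ e = idm′ m (cast-injective (R-spec b)
      (punchOut-injective (identifying≢shared idm ∘ cast-injective (R-spec b))
                          (identifying≢shared idm′ ∘ cast-injective (R-spec b)) e))

    key : Fin M → Σ Block (λ b → Fin (R b))
    key m = proj₁ (identify m) , residue (proj₂ (identify m))

    key-injective : Injective _≡_ _≡_ key
    key-injective {m} {m′} e = uncurry (aligned (proj₂ (identify m)) (proj₂ (identify m′))) (Σ-≡,≡←≡ e)
      where
      aligned : ∀ {b b′} (idm : Identifies b m) (idm′ : Identifies b′ m′) (b≡b′ : b ≡ b′) →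
                subst (λ b → Fin (R b)) b≡b′ (residue idm) ≡ residue idm′ → m ≡ m′
      aligned idm idm′ refl = residue-injective idm idm′

    size-bound : ∀ {K} {ι : Σ Block (λ b → Fin (R b)) → Fin K} → Injective _≡_ _≡_ ι → M ≤ K
    size-bound ι-injective = injective⇒≤ (key-injective ∘ ι-injective)

ceil-split : ∀ n d → ⌈ n /suc d ⌉ ≡ (n % suc d + d) / suc d + n / suc d
ceil-split n d = begin
  (n + d) / w             ≡⟨ cong (λ x → (x + d) / w) (m≡m%n+[m/n]*n n w) ⟩
  (r + l * w + d) / w     ≡⟨ cong (_/ w) (xy∙z≈xz∙y r (l * w) d) ⟩
  (r + d + l * w) / w     ≡⟨ +-distrib-/-∣ʳ (r + d) (divides-refl l) ⟩
  (r + d) / w + l * w / w ≡⟨ cong ((r + d) / w +_) (m*n/n≡m l w) ⟩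
  (r + d) / w + l         ∎
  where
  open ≡-Reasoning
  w = suc d
  r = n % w
  l = n / w

-- For a remainder r < d + 1 the correction ⌈r/(d+1)⌉ is 0 or 1, so r · ⌈r/(d+1)⌉ = r.
remainder-scaled : ∀ r d → r < suc d → r * ((r + d) / suc d) ≡ r
remainder-scaled zero    d _ = refl
remainder-scaled (suc r) d (s≤s r<d) = trans (cong (suc r *_) ceil≡1) (ℕₚ.*-identityʳ (suc r))
  where
  ceil≡1 : (suc r + d) / suc d ≡ 1
  ceil≡1 = trans (m/n≡1+[m∸n]/n (s≤s (ℕₚ.m≤n+m d r)))
    (cong suc (trans (cong (_/ suc d) (ℕₚ.m+n∸n≡m r d)) (m<n⇒m/n≡0 (ℕₚ.m≤n⇒m≤1+n r<d))))

tiling : ∀ n d → n ≡ n % suc d * ⌈ n /suc d ⌉ + (suc d ∸ n % suc d) * (n / suc d)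
tiling n d = begin
  n                                    ≡⟨ m≡m%n+[m/n]*n n w ⟩
  r + l * w                            ≡⟨ cong₂ _+_ (sym (remainder-scaled r d (m%n<n n w))) (ℕₚ.*-comm l w) ⟩
  r * c + w * l                        ≡⟨ cong (λ x → r * c + x * l) (sym (ℕₚ.m+[n∸m]≡n (ℕₚ.<⇒≤ (m%n<n n w)))) ⟩
  r * c + (r + (w ∸ r)) * l            ≡⟨ cong (r * c +_) (ℕₚ.*-distribʳ-+ l r (w ∸ r)) ⟩
  r * c + (r * l + (w ∸ r) * l)        ≡⟨ sym (ℕₚ.+-assoc (r * c) (r * l) _) ⟩
  r * c + r * l + (w ∸ r) * l          ≡⟨ cong (_+ (w ∸ r) * l) (sym (ℕₚ.*-distribˡ-+ r c l)) ⟩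
  r * (c + l) + (w ∸ r) * l            ≡⟨ cong (λ x → r * x + (w ∸ r) * l) (sym (ceil-split n d)) ⟩
  r * ⌈ n /suc d ⌉ + (w ∸ r) * l       ∎
  where
  open ≡-Reasoning
  w = suc d
  r = n % w
  l = n / w
  c = (r + d) / w

floor≤ceil : ∀ n d → n / suc d ≤ ⌈ n /suc d ⌉
floor≤ceil n d = subst (n / suc d ≤_) (sym (ceil-split n d)) (ℕₚ.m≤n+m _ _)

pow≡suc : ∀ q .{{_ : NonZero q}} s → q ^ s ≡ suc (q ^ s ∸ 1)
pow≡suc q s = trans (sym (ℕₚ.m∸n+n≡m (ℕₚ.m^n>0 q s))) (ℕₚ.+-comm (q ^ s ∸ 1) 1)

kindSize : ∀ {a s} → ℕ → ℕ → Fin a ⊎ Fin s → ℕ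
kindSize u l (inj₁ _) = u
kindSize u l (inj₂ _) = l

place : ∀ {a s} u l (b : Fin a ⊎ Fin s) → Fin (kindSize u l b) → Fin (a * u + s * l)
place {a} {s} u l (inj₁ x) p = join (a * u) (s * l) (inj₁ (combine x p))
place {a} {s} u l (inj₂ x) p = join (a * u) (s * l) (inj₂ (combine x p))

module _ {a s : ℕ} (u l : ℕ) where

  private
    Position : Set
    Position = Σ (Fin a ⊎ Fin s) (λ b → Fin (kindSize u l b))

    inFirst : Fin a × Fin u → Position
    inFirst (x , p) = inj₁ x , p

    inSecond : Fin s × Fin l → Position
    inSecond (x , p) = inj₂ x , p

    fromHalves : Fin (a * u) ⊎ Fin (s * l) → Position
    fromHalves (inj₁ y) = inFirst (remQuot u y)
    fromHalves (inj₂ y) = inSecond (remQuot l y)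

    place-fromHalves : ∀ z → uncurry (place u l) (fromHalves z) ≡ join (a * u) (s * l) z
    place-fromHalves (inj₁ y) = cong (join (a * u) (s * l) ∘ inj₁) (combine-remQuot {a} u y)
    place-fromHalves (inj₂ y) = cong (join (a * u) (s * l) ∘ inj₂) (combine-remQuot {s} l y)

    fromHalves-place : ∀ b p → fromHalves (splitAt (a * u) (place u l b p)) ≡ (b , p)
    fromHalves-place (inj₁ x) p = trans (cong fromHalves (splitAt-join (a * u) (s * l) (inj₁ (combine x p))))
                                        (cong inFirst (remQuot-combine x p))
    fromHalves-place (inj₂ x) p = trans (cong fromHalves (splitAt-join (a * u) (s * l) (inj₂ (combine x p))))
                                        (cong inSecond (remQuot-combine x p))

  place-onto : ∀ i → ∃₂ λ b p → place u l b p ≡ i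
  place-onto i = let (b , p) = fromHalves (splitAt (a * u) i) in
    b , p , trans (place-fromHalves (splitAt (a * u) i)) (join-splitAt (a * u) (s * l) i)

  place-injective : Injective _≡_ _≡_ (uncurry (place u l))
  place-injective {b , p} {b′ , p′} e = begin
    (b , p)                                       ≡⟨ sym (fromHalves-place b p) ⟩
    fromHalves (splitAt (a * u) (place u l b p))  ≡⟨ cong (fromHalves ∘ splitAt (a * u)) e ⟩
    fromHalves (splitAt (a * u) (place u l b′ p′)) ≡⟨ fromHalves-place b′ p′ ⟩
    (b′ , p′)                                     ∎
    where open ≡-Reasoning

twoLengthCover : ∀ {n} a s u l → n ≡ a * u + s * l → Cover n
twoLengthCover {n} a s u l n≡ = record
  { Block     = Fin a ⊎ Fin s
  ; count     = a + s
  ; enum      = splitAt a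
  ; enum-onto = λ b → join a s b , splitAt-join a s b
  ; size      = kindSize u l
  ; pos       = λ b p → cast (sym n≡) (place u l b p)
  ; pos-onto  = λ i → let (b , p , e) = place-onto u l (cast n≡ i) in
      b , p , trans (cong (cast (sym n≡)) e) (cast-involutive (sym n≡) n≡ i)
  }

theorem4 : (n q t : ℕ) → 1 ≤ q → 3 ≤ t → 2 ≤ n →
    Σ ℕ (λ M₀ → Σ (Code n M₀ q) (λ C₀ → StronglySeparable t C₀ × q < M₀)) →
    (M : ℕ) → (C : Code n M q) → StronglySeparable t C → M ≤ bound t n q
theorem4 n q@(suc _) (suc (suc d)) _ (s≤s (s≤s _)) _ _ M C sep =
  by-cases (every-block-or-exception ambiguous?)
  where
  w = suc d
  r = n % w
  u = ⌈ n /suc d ⌉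
  l = n / w
  open BlockArgument C (twoLengthCover r (w ∸ r) u l (tiling n d))

  -- The d + 1 blocks are fewer than t = d + 2.
  identify : ∀ m → ∃ λ b → Identifies b m
  identify = identifying-block sep (s≤s (ℕₚ.≤-reflexive (ℕₚ.m+[n∸m]≡n (ℕₚ.<⇒≤ (m%n<n n w)))))

  R : Fin r ⊎ Fin (w ∸ r) → ℕ
  R = kindSize (q ^ u ∸ 1) (q ^ l ∸ 1)

  R-spec : ∀ b → q ^ kindSize u l b ≡ suc (R b)
  R-spec (inj₁ _) = pow≡suc q u
  R-spec (inj₂ _) = pow≡suc q l

  block≤ceil : ∀ b → q ^ kindSize u l b ≤ q ^ u
  block≤ceil (inj₁ _) = ℕₚ.≤-refl
  block≤ceil (inj₂ _) = ℕₚ.^-monoʳ-≤ q (floor≤ceil n d)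

  by-cases : (∀ b → Ambiguous b) ⊎ (∃ λ b → ¬ Ambiguous b) → M ≤ bound (suc (suc d)) n q
  by-cases (inj₁ all-ambiguous) = ℕₚ.≤-trans
    (AllAmbiguous.size-bound R R-spec all-ambiguous identify (place-injective (q ^ u ∸ 1) (q ^ l ∸ 1)))
    (ℕₚ.m≤n⊔m _ _)
  by-cases (inj₂ (b , unambiguous)) = ℕₚ.≤-trans
    (injective⇒≤ (unambiguous⇒injective {b} unambiguous))
    (ℕₚ.≤-trans (block≤ceil b) (ℕₚ.m≤m⊔n _ _))
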